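{- For any $\delta>0$ and $n_1,n_2\in\mathbb N$ there exists $N\in\mathbb N$ such that the following holds. Let $\mathcal A$ be an $[N]$-reduced $3$-graph with vertex classes $\mathcal P_{ij}$, and suppose that for each $i<j<j'<k$ in $[N]$ there is a subset $L_{ijj'k}\subseteq\mathcal P_{ij}$ with $|L_{ijj'k}|\ge\delta|\mathcal P_{ij}|$. Then there exist $I_1,I_2\subseteq[N]$ with $|I_1|=n_1$, $|I_2|=n_2$ and $\max I_1<\min I_2$ (so that the induced subhypergraph of $\mathcal A$ with index set $I_1\cup I_2$ is obtained), and vertices $\ell_{ij}\in\mathcal P_{ij}$ for all $i<j$ in $I_1$ such that $$\ell_{ij}\in\bigcap_{j'\in I_1,\ k\in I_2,\ j<j'<k} L_{ijj'k}.$$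
   Context: For a finite index set $I\subset\mathbb N$, an $I$-reduced $3$-graph $\mathcal A$ consists of: for each pair $i<j$ in $I$ a finite nonempty set $\mathcal P_{ij}$ (vertex classes, pairwise disjoint), and for each triple $i<j<k$ in $I$ a $3$-partite $3$-graph $\mathcal A_{ijk}$ (constituent) with parts $\mathcal P_{ij},\mathcal P_{jk},\mathcal P_{ik}$; $\mathcal A$ is the union of these. For $I'\subseteq I$, the induced subhypergraph with index set $I'$ consists of the classes $\mathcal P_{ij}$, $i<j\in I'$, and constituents $\mathcal A_{ijk}$, $i<j<k\in I'$.
   Formalization: The parameter δ ranges over the positive rationals. -}

module Defs where

open import Data.Nat using (ℕ)
open import Data.Bool using (Bool)
open import Data.Fin using (Fin; _<_)
open import Data.Integer using (+_)
open import Data.Rational using (ℚ; _/_)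

ℕ→ℚ : ℕ → ℚ
ℕ→ℚ n = (+ n) / 1

-- For each pair i < j the vertex class P_ij is a finite nonempty set,
-- represented as Fin (cls i j) (classes for distinct pairs are formally
-- disjoint since they live in different types / a disjoint union).
-- For each triple i < j < k the constituent A_ijk is a 3-partite 3-graph
-- with parts P_ij, P_jk, P_ik, given by its edge indicator.
record Reduced3Graph (N : ℕ) : Set where
  field
    cls      : (i j : Fin N) → ℕ
    nonempty : (i j : Fin N) → i < j → Data.Nat._<_ 0 (cls i j)
    edge     : (i j k : Fin N) → i < j → j < k →
               Fin (cls i j) → Fin (cls j k) → Fin (cls i k) → Bool

module Submission where

-- Only the vertex classes matter.  Let r be the denominator of δ, so
-- that |L_ijj′k| ≥ |P_ij|/r.  The index sets are chosen greedily from two pools X < Y of candidates: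
-- the next index m = min X joins I₁, and for each earlier i ∈ I₁ a vertex ℓ_im ∈ P_im is fixed while
-- X and Y are shrunk so that ℓ_im ∈ L_imj′k for all surviving j′ ∈ X, k ∈ Y.  Each such step is a
-- Kővári–Sós–Turán argument: double counting yields a vertex v lying in L_imj′k for at least a
-- 1/r-fraction of the pairs (j′,k) ∈ X × Y; a 1/2r-fraction of the j′ ∈ X then have ≥ |Y|/2r such k,
-- and choosing q columns one at a time, each time one with the most common neighbours, keeps a
-- (4r)^(-q)-fraction of these rows.  Thus X shrinks by a bounded factor and Y to a prescribed size, so
-- a large enough N survives all n₁(n₁+1)/2 steps and leaves n₂ indices in Y for I₂.

module Subsets where

  open import Data.Bool using (Bool; true; false)
  open import Data.Empty using (⊥-elim)
  open import Data.Fin using (Fin; zero; suc; _<_) renaming (_≤_ to _≤ᶠ_)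
  open import Data.Fin.Subset
    using (Subset; inside; outside; _∈_; _∉_; _⊆_; _∩_; _∪_; _-_; ⁅_⁆; ∣_∣; Nonempty)
    renaming (⊥ to ∅)
  open import Data.Fin.Subset.Properties
    using (nonempty?; ∉⊥; p─⊥≡p; ∪-identityʳ; ∣⊥∣≡0; ⊥⊆; in⊆in; out⊆; x∈p∪q⁻; x∈⁅y⁆⇒x≡y)
  open import Data.List using (List; []; _∷_; length)
  open import Data.List.Membership.Propositional using () renaming (_∈_ to _∈ₗ_)
  open import Data.List.Relation.Unary.All as All using ()
  open import Data.List.Relation.Unary.Any using (here; there)
  open import Data.List.Relation.Unary.Unique.Propositional using (Unique)
  open import Data.List.Relation.Unary.AllPairs using ([]; _∷_)
  open import Data.Nat using (ℕ; zero; suc; _+_; _*_; _≤_; z≤n; s≤s)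
  open import Data.Nat.Properties
  open import Algebra.Properties.CommutativeSemigroup +-commutativeSemigroup
    using () renaming (interchange to +-interchange; x∙yz≈y∙xz to +-left-comm)
  open import Data.Product using (∃; _×_; _,_)
  open import Data.Sum using (_⊎_; inj₁; inj₂)
  open import Data.Vec using ([]; _∷_; here; there; lookup; tabulate)
  open import Data.Vec.Properties using (lookup∘tabulate; []=⇒lookup)
  open import Function using (_∘_)
  open import Relation.Nullary using (yes; no)
  open import Relation.Binary.PropositionalEquality

  private variable
    m n : ℕ

  𝟙 : Bool → ℕ
  𝟙 true  = 1
  𝟙 false = 0

  𝟙≤1 : ∀ b → 𝟙 b ≤ 1
  𝟙≤1 true  = ≤-refl
  𝟙≤1 false = z≤n

  ∑ : Subset n → (Fin n → ℕ) → ℕ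
  ∑ []            f = 0
  ∑ (inside ∷ p)  f = f zero + ∑ p (f ∘ suc)
  ∑ (outside ∷ p) f = ∑ p (f ∘ suc)

  syntax ∑ p (λ x → e) = ∑[ x ∈ p ] e

  ∑-cong : ∀ (p : Subset n) {f g : Fin n → ℕ} → (∀ x → f x ≡ g x) → ∑ p f ≡ ∑ p g
  ∑-cong []            f≗g = refl
  ∑-cong (inside ∷ p)  f≗g = cong₂ _+_ (f≗g zero) (∑-cong p (f≗g ∘ suc))
  ∑-cong (outside ∷ p) f≗g = ∑-cong p (f≗g ∘ suc)

  ∑-mono : ∀ (p : Subset n) {f g : Fin n → ℕ} → (∀ {x} → x ∈ p → f x ≤ g x) → ∑ p f ≤ ∑ p g
  ∑-mono []            f≤g = z≤n
  ∑-mono (inside ∷ p)  f≤g = +-mono-≤ (f≤g here) (∑-mono p (f≤g ∘ there))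
  ∑-mono (outside ∷ p) f≤g = ∑-mono p (f≤g ∘ there)

  ∑-const : ∀ (p : Subset n) c → ∑[ x ∈ p ] c ≡ ∣ p ∣ * c
  ∑-const []            c = refl
  ∑-const (inside ∷ p)  c = cong (c +_) (∑-const p c)
  ∑-const (outside ∷ p) c = ∑-const p c

  ∣p∣≡∑1 : ∀ (p : Subset n) → ∣ p ∣ ≡ ∑[ x ∈ p ] 1
  ∣p∣≡∑1 p = trans (sym (*-identityʳ ∣ p ∣)) (sym (∑-const p 1))

  ∑-*ˡ : ∀ (p : Subset n) c (f : Fin n → ℕ) → ∑[ x ∈ p ] (c * f x) ≡ c * ∑ p f
  ∑-*ˡ []            c f = sym (*-zeroʳ c)
  ∑-*ˡ (inside ∷ p)  c f =
    trans (cong (c * f zero +_) (∑-*ˡ p c (f ∘ suc))) (sym (*-distribˡ-+ c _ _))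
  ∑-*ˡ (outside ∷ p) c f = ∑-*ˡ p c (f ∘ suc)

  ∑-*ʳ : ∀ (p : Subset n) c (f : Fin n → ℕ) → ∑[ x ∈ p ] (f x * c) ≡ ∑ p f * c
  ∑-*ʳ p c f = trans (∑-cong p (λ x → *-comm (f x) c)) (trans (∑-*ˡ p c f) (*-comm c (∑ p f)))

  ∑-+ : ∀ (p : Subset n) (f g : Fin n → ℕ) → ∑[ x ∈ p ] (f x + g x) ≡ ∑ p f + ∑ p g
  ∑-+ []            f g = refl
  ∑-+ (inside ∷ p)  f g =
    trans (cong (f zero + g zero +_) (∑-+ p (f ∘ suc) (g ∘ suc))) (+-interchange (f zero) (g zero) _ _)
  ∑-+ (outside ∷ p) f g = ∑-+ p (f ∘ suc) (g ∘ suc)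

  ∑-comm : ∀ (p : Subset n) (q : Subset m) (f : Fin n → Fin m → ℕ) →
           ∑[ x ∈ p ] ∑[ y ∈ q ] f x y ≡ ∑[ y ∈ q ] ∑[ x ∈ p ] f x y
  ∑-comm []            q f = trans (sym (*-zeroʳ ∣ q ∣)) (sym (∑-const q 0))
  ∑-comm (inside ∷ p)  q f = trans (cong (∑ q (f zero) +_) (∑-comm p q (f ∘ suc))) (sym (∑-+ q (f zero) _))
  ∑-comm (outside ∷ p) q f = ∑-comm p q (f ∘ suc)

  ∑-remove : ∀ {p : Subset n} {x} (f : Fin n → ℕ) → x ∈ p → ∑ p f ≡ f x + ∑ (p - x) f
  ∑-remove {p = inside ∷ p}  f here        = cong (λ q → f zero + ∑ q (f ∘ suc)) (sym (p─⊥≡p p))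
  ∑-remove {p = inside ∷ p}  f (there x∈p) =
    trans (cong (f zero +_) (∑-remove (f ∘ suc) x∈p)) (+-left-comm (f zero) (f (suc _)) _)
  ∑-remove {p = outside ∷ p} f (there x∈p) = ∑-remove (f ∘ suc) x∈p

  ∑-indicator : ∀ (p q : Subset n) → ∑[ x ∈ p ] 𝟙 (lookup q x) ≡ ∣ p ∩ q ∣
  ∑-indicator []            []            = refl
  ∑-indicator (inside ∷ p)  (inside ∷ q)  = cong suc (∑-indicator p q)
  ∑-indicator (inside ∷ p)  (outside ∷ q) = ∑-indicator p q
  ∑-indicator (outside ∷ p) (_ ∷ q)       = ∑-indicator p q

  ∈-tabulate⁻ : ∀ {f : Fin n → Bool} {x} → x ∈ tabulate f → f x ≡ true
  ∈-tabulate⁻ {f = f} {x} x∈ = trans (sym (lookup∘tabulate f x)) ([]=⇒lookup x∈)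

  x∈p∪⁅y⁆⁻ : ∀ {p : Subset n} {x y} → x ∈ p ∪ ⁅ y ⁆ → x ∈ p ⊎ x ≡ y
  x∈p∪⁅y⁆⁻ {p = p} {y = y} x∈ with x∈p∪q⁻ p ⁅ y ⁆ x∈
  ... | inj₁ x∈p   = inj₁ x∈p
  ... | inj₂ x∈⁅y⁆ = inj₂ (x∈⁅y⁆⇒x≡y y x∈⁅y⁆)

  x∉p-x : ∀ {p : Subset n} {x} → x ∉ p - x
  x∉p-x {p = inside ∷ p}  {zero}  ()
  x∉p-x {p = outside ∷ p} {zero}  ()
  x∉p-x {p = inside ∷ p}  {suc x} (there x∈p-x) = x∉p-x x∈p-x
  x∉p-x {p = outside ∷ p} {suc x} (there x∈p-x) = x∉p-x x∈p-x

  1≤∣p∣⇒Nonempty : ∀ {p : Subset n} → 1 ≤ ∣ p ∣ → Nonempty p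
  1≤∣p∣⇒Nonempty {p = inside ∷ p}  _ = zero , here
  1≤∣p∣⇒Nonempty {p = outside ∷ p} 1≤∣p∣ with 1≤∣p∣⇒Nonempty 1≤∣p∣
  ... | x , x∈p = suc x , there x∈p

  ∣p∣≡1+∣p-x∣ : ∀ {p : Subset n} {x} → x ∈ p → ∣ p ∣ ≡ suc ∣ p - x ∣
  ∣p∣≡1+∣p-x∣ {p = p} {x} x∈p = begin
    ∣ p ∣                   ≡⟨ ∣p∣≡∑1 p ⟩
    ∑[ y ∈ p ] 1            ≡⟨ ∑-remove (λ _ → 1) x∈p ⟩
    suc (∑[ y ∈ p - x ] 1)  ≡⟨ cong suc (∣p∣≡∑1 (p - x)) ⟨
    suc ∣ p - x ∣           ∎
    where open ≡-Reasoning

  ∣p∪⁅x⁆∣≡1+∣p∣ : ∀ {p : Subset n} {x} → x ∉ p → ∣ p ∪ ⁅ x ⁆ ∣ ≡ suc ∣ p ∣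
  ∣p∪⁅x⁆∣≡1+∣p∣ {p = outside ∷ p} {zero}  _   = cong (suc ∘ ∣_∣) (∪-identityʳ p)
  ∣p∪⁅x⁆∣≡1+∣p∣ {p = inside ∷ p}  {zero}  x∉p = ⊥-elim (x∉p here)
  ∣p∪⁅x⁆∣≡1+∣p∣ {p = inside ∷ p}  {suc x} x∉p = cong suc (∣p∪⁅x⁆∣≡1+∣p∣ (x∉p ∘ there))
  ∣p∪⁅x⁆∣≡1+∣p∣ {p = outside ∷ p} {suc x} x∉p = ∣p∪⁅x⁆∣≡1+∣p∣ (x∉p ∘ there)

  ∃-subset-of-size : ∀ (p : Subset n) {k} → k ≤ ∣ p ∣ → ∃ λ q → q ⊆ p × ∣ q ∣ ≡ k
  ∃-subset-of-size {n} p {zero} _ = ∅ , ⊥⊆ , ∣⊥∣≡0 n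
  ∃-subset-of-size (inside ∷ p) {suc k} (s≤s k≤∣p∣) with ∃-subset-of-size p k≤∣p∣
  ... | q , q⊆p , ∣q∣≡k = inside ∷ q , in⊆in q⊆p , cong suc ∣q∣≡k
  ∃-subset-of-size (outside ∷ p) {suc k} k<∣p∣ with ∃-subset-of-size p k<∣p∣
  ... | q , q⊆p , ∣q∣≡k = outside ∷ q , out⊆ q⊆p , ∣q∣≡k

  minimum : ∀ {p : Subset n} → Nonempty p → ∃ λ x → x ∈ p × (∀ {y} → y ∈ p → x ≤ᶠ y)
  minimum {p = inside ∷ p}  _                   = zero , here , λ _ → z≤n
  minimum {p = outside ∷ p} (suc x , there x∈p) with minimum (x , x∈p)
  ... | m , m∈p , m≤ = suc m , there m∈p , λ { (there y∈p) → s≤s (m≤ y∈p) }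

  argmax : ∀ {p : Subset n} (f : Fin n → ℕ) → Nonempty p →
           ∃ λ x → x ∈ p × (∀ {y} → y ∈ p → f y ≤ f x)
  argmax {p = outside ∷ p} f (suc x , there x∈p) with argmax (f ∘ suc) (x , x∈p)
  ... | m , m∈p , f≤fm = suc m , there m∈p , λ { (there y∈p) → f≤fm y∈p }
  argmax {p = inside ∷ p} f _ with nonempty? p
  ... | no p≡∅ = zero , here , λ { here → ≤-refl ; (there y∈p) → ⊥-elim (p≡∅ (_ , y∈p)) }
  ... | yes p≢∅ with argmax (f ∘ suc) p≢∅
  ...   | m , m∈p , f≤fm with f zero ≤? f (suc m)
  ...     | yes f0≤ = suc m , there m∈p , λ { here → f0≤ ; (there y∈p) → f≤fm y∈p }
  ...     | no f0≰  = zero , here , λ { here → ≤-refl ; (there y∈p) → ≤-trans (f≤fm y∈p) (≰⇒≥ f0≰) }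

  ∃-above-average : ∀ {p : Subset n} (f : Fin n → ℕ) → Nonempty p → ∃ λ x → x ∈ p × ∑ p f ≤ ∣ p ∣ * f x
  ∃-above-average {p = p} f p≢∅ with argmax f p≢∅
  ... | x , x∈p , f≤fx = x , x∈p , ≤-trans (∑-mono p f≤fx) (≤-reflexive (∑-const p (f x)))

  initial : ∀ a {b} → Subset (a + b)
  initial zero    = ∅
  initial (suc a) = inside ∷ initial a

  ∣initial∣ : ∀ a {b} → ∣ initial a {b} ∣ ≡ a
  ∣initial∣ zero {b} = ∣⊥∣≡0 b
  ∣initial∣ (suc a)  = cong suc (∣initial∣ a)

  initial<rest : ∀ a {b} {x y : Fin (a + b)} → x ∈ initial a → y ∉ initial a → x < y
  initial<rest zero    x∈∅ _ = ⊥-elim (∉⊥ x∈∅)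
  initial<rest (suc a) {x = zero}  {zero}  _           y∉ = ⊥-elim (y∉ here)
  initial<rest (suc a) {x = zero}  {suc y} _           _  = s≤s z≤n
  initial<rest (suc a) {x = suc x} {zero}  _           y∉ = ⊥-elim (y∉ here)
  initial<rest (suc a) {x = suc x} {suc y} (there x∈) y∉ = s≤s (initial<rest a x∈ (y∉ ∘ there))

  fromList : List (Fin n) → Subset n
  fromList []       = ∅
  fromList (x ∷ xs) = fromList xs ∪ ⁅ x ⁆

  ∈-fromList⁻ : ∀ {xs : List (Fin n)} {x} → x ∈ fromList xs → x ∈ₗ xs
  ∈-fromList⁻ {xs = []}     x∈ = ⊥-elim (∉⊥ x∈)
  ∈-fromList⁻ {xs = y ∷ xs} x∈ with x∈p∪⁅y⁆⁻ {p = fromList xs} x∈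
  ... | inj₁ x∈xs = there (∈-fromList⁻ x∈xs)
  ... | inj₂ x≡y  = here x≡y

  ∣fromList∣ : ∀ {xs : List (Fin n)} → Unique xs → ∣ fromList xs ∣ ≡ length xs
  ∣fromList∣ {n} []           = ∣⊥∣≡0 n
  ∣fromList∣ (x∉xs ∷ unique) =
    trans (∣p∪⁅x⁆∣≡1+∣p∣ (λ x∈ → All.lookup x∉xs (∈-fromList⁻ x∈) refl)) (cong suc (∣fromList∣ unique))

module DoubleCounting where

  open Subsets
  open import Data.Bool using (Bool; true; false; T)
  open import Data.Empty using (⊥-elim)
  open import Data.Fin using (Fin; zero; suc)
  open import Data.Fin.Subset
    using (Subset; _∈_; _⊆_; _∩_; _∪_; _-_; ⁅_⁆; ∣_∣; Nonempty; ⊤) renaming (⊥ to ∅)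
  open import Data.Fin.Subset.Properties
    using (∩-identityˡ; ∣⊥∣≡0; ∣⊤∣≡n; ∉⊥; ⊥⊆; p∩q⊆p; p∩q⊆q; x∈p∩q⁻; p─q⊆p; ∣p─q∣≤∣p∣)
  open import Data.Nat using (ℕ; zero; suc; _+_; _*_; _^_; _≤_; z≤n; s≤s; NonZero; >-nonZero; _≤ᵇ_)
  open import Data.Nat.Properties
  open import Algebra.Properties.CommutativeSemigroup *-commutativeSemigroup
    using () renaming (x∙yz≈y∙xz to *-left-comm)
  open import Data.Product using (∃; _×_; _,_)
  open import Data.Sum using ([_,_])
  open import Data.Unit using (tt)
  open import Data.Vec using (here; lookup; tabulate)
  open import Data.Vec.Properties using (lookup∘tabulate)
  open import Function using (_∘_)
  open import Relation.Nullary.Reflects using (ofʸ; ofⁿ)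
  open import Relation.Binary.PropositionalEquality hiding ([_])

  private variable
    m n : ℕ

  link-weight : ∀ {c} (X : Subset m) (Y : Subset n) → (Fin m → Fin n → Subset c) → Fin c → ℕ
  link-weight X Y E x = ∑[ j ∈ X ] ∑[ k ∈ Y ] 𝟙 (lookup (E j k) x)

  ⊤-nonempty : ∀ n .{{_ : NonZero n}} → Nonempty (⊤ {n})
  ⊤-nonempty (suc n) = zero , here

  ∃-popular : ∀ {c} .{{_ : NonZero c}} r (X : Subset m) (Y : Subset n) (E : Fin m → Fin n → Subset c) →
              (∀ {j k} → j ∈ X → k ∈ Y → c ≤ r * ∣ E j k ∣) →
              ∃ λ x → ∣ X ∣ * ∣ Y ∣ ≤ r * link-weight X Y E x
  ∃-popular {c = c} r X Y E dense with ∃-above-average (link-weight X Y E) (⊤-nonempty c)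
  ... | x , _ , ∑w≤ = x , *-cancelˡ-≤ c (begin
    c * (∣ X ∣ * ∣ Y ∣)                     ≡⟨ trans (*-comm c _) (*-assoc ∣ X ∣ ∣ Y ∣ c) ⟩
    ∣ X ∣ * (∣ Y ∣ * c)                     ≡⟨ trans (∑-cong X (λ _ → ∑-const Y c)) (∑-const X _) ⟨
    ∑[ j ∈ X ] ∑[ k ∈ Y ] c                 ≤⟨ ∑-mono X (λ j∈X → ∑-mono Y (dense j∈X)) ⟩
    ∑[ j ∈ X ] ∑[ k ∈ Y ] (r * ∣ E j k ∣)   ≡⟨ trans (∑-cong X (λ j → ∑-*ˡ Y r _)) (∑-*ˡ X r _) ⟩
    r * ∑[ j ∈ X ] ∑[ k ∈ Y ] ∣ E j k ∣     ≡⟨ cong (r *_) ∑∣E∣≡∑w ⟩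
    r * ∑[ x ∈ ⊤ ] w x                      ≤⟨ *-monoʳ-≤ r ∑w≤ ⟩
    r * (∣ ⊤ {c} ∣ * w x)                   ≡⟨ cong (λ k → r * (k * w x)) (∣⊤∣≡n c) ⟩
    r * (c * w x)                           ≡⟨ *-left-comm r c _ ⟩
    c * (r * w x)                           ∎)
    where
    open ≤-Reasoning
    w = link-weight X Y E
    ∣E∣≡∑𝟙 : ∀ j k → ∣ E j k ∣ ≡ ∑[ x ∈ ⊤ ] 𝟙 (lookup (E j k) x)
    ∣E∣≡∑𝟙 j k = trans (cong ∣_∣ (sym (∩-identityˡ (E j k)))) (sym (∑-indicator ⊤ (E j k)))
    ∑∣E∣≡∑w : ∑[ j ∈ X ] ∑[ k ∈ Y ] ∣ E j k ∣ ≡ ∑[ x ∈ ⊤ ] w x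
    ∑∣E∣≡∑w = begin-equality
      ∑[ j ∈ X ] ∑[ k ∈ Y ] ∣ E j k ∣                          ≡⟨ ∑-cong X (λ j → ∑-cong Y (∣E∣≡∑𝟙 j)) ⟩
      ∑[ j ∈ X ] ∑[ k ∈ Y ] ∑[ x ∈ ⊤ ] 𝟙 (lookup (E j k) x)   ≡⟨ ∑-cong X (λ j → ∑-comm Y (⊤ {c}) _) ⟩
      ∑[ j ∈ X ] ∑[ x ∈ ⊤ ] ∑[ k ∈ Y ] 𝟙 (lookup (E j k) x)   ≡⟨ ∑-comm X (⊤ {c}) _ ⟩
      ∑[ x ∈ ⊤ ] w x                                            ∎

  heavy : ℕ → (Fin m → ℕ) → ℕ → Subset m → Subset m
  heavy a d β X = X ∩ tabulate (λ j → β ≤ᵇ a * d j)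

  heavy⁻ : ∀ {a d β} {X : Subset m} {j} → j ∈ heavy a d β X → j ∈ X × β ≤ a * d j
  heavy⁻ {a = a} {d} {β} {X} {j} j∈H with x∈p∩q⁻ X _ j∈H
  ... | j∈X , j∈T = j∈X , ≤ᵇ⇒≤ β (a * d j) (subst T (sym (∈-tabulate⁻ j∈T)) tt)

  -- The rows outside heavy carry less than half of the mass ∑ X d ≥ ∣ X ∣ β / r.
  ∣X∣≤2r*∣heavy∣ : ∀ r (d : Fin m → ℕ) β .{{_ : NonZero β}} (X : Subset m) →
                   (∀ {j} → j ∈ X → d j ≤ β) → ∣ X ∣ * β ≤ r * ∑ X d →
                   ∣ X ∣ ≤ 2 * r * ∣ heavy (2 * r) d β X ∣
  ∣X∣≤2r*∣heavy∣ r d β X d≤β mass = *-cancelʳ-≤ _ _ β (+-cancelʳ-≤ (∣ X ∣ * β) _ _ (begin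
    ∣ X ∣ * β + ∣ X ∣ * β                        ≤⟨ +-mono-≤ mass mass ⟩
    r * ∑ X d + r * ∑ X d                        ≡⟨ cong (r * ∑ X d +_) (+-identityʳ _) ⟨
    2 * (r * ∑ X d)                              ≡⟨ trans (∑-*ˡ X a d) (*-assoc 2 r _) ⟨
    ∑[ j ∈ X ] (a * d j)                         ≤⟨ ∑-mono X split ⟩
    ∑[ j ∈ X ] (𝟙 (isHeavy j) * (a * β) + β)    ≡⟨ ∑-+ X _ _ ⟩
    ∑[ j ∈ X ] (𝟙 (isHeavy j) * (a * β)) + ∑[ j ∈ X ] β
                                                 ≡⟨ cong₂ _+_ (∑-*ʳ X (a * β) _) (∑-const X β) ⟩
    ∑[ j ∈ X ] 𝟙 (isHeavy j) * (a * β) + ∣ X ∣ * β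
                                                 ≡⟨ cong (λ h → h * (a * β) + ∣ X ∣ * β) count-heavy ⟩
    ∣ H ∣ * (a * β) + ∣ X ∣ * β                  ≡⟨ cong (_+ ∣ X ∣ * β) (*-left-comm ∣ H ∣ a β) ⟩
    a * (∣ H ∣ * β) + ∣ X ∣ * β                  ≡⟨ cong (_+ ∣ X ∣ * β) (*-assoc a ∣ H ∣ β) ⟨
    a * ∣ H ∣ * β + ∣ X ∣ * β                    ∎))
    where
    open ≤-Reasoning
    a = 2 * r
    H = heavy a d β X
    isHeavy : Fin _ → Bool
    isHeavy j = β ≤ᵇ a * d j
    split : ∀ {j} → j ∈ X → a * d j ≤ 𝟙 (isHeavy j) * (a * β) + β
    split {j} j∈X with isHeavy j | ≤ᵇ-reflects-≤ β (a * d j)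
    ... | true  | ofʸ _  = ≤-trans (*-monoʳ-≤ a (d≤β j∈X)) (≤-trans (≤-reflexive (sym (+-identityʳ _))) (m≤m+n _ β))
    ... | false | ofⁿ β≰ = <⇒≤ (≰⇒> β≰)
    count-heavy : ∑[ j ∈ X ] 𝟙 (isHeavy j) ≡ ∣ H ∣
    count-heavy = trans (∑-cong X (λ j → cong 𝟙 (sym (lookup∘tabulate isHeavy j)))) (∑-indicator X _)

  halve-slack : ∀ a d t β → β ≤ a * (d + t) → 2 * a * t ≤ β → β ≤ 2 * a * d
  halve-slack a d t β β≤ 2at≤β = +-cancelʳ-≤ β β (2 * a * d) (begin
    β + β                  ≡⟨ cong (β +_) (+-identityʳ β) ⟨
    2 * β                  ≤⟨ *-monoʳ-≤ 2 β≤ ⟩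
    2 * (a * (d + t))      ≡⟨ *-assoc 2 a (d + t) ⟨
    2 * a * (d + t)        ≡⟨ *-distribˡ-+ (2 * a) d t ⟩
    2 * a * d + 2 * a * t  ≤⟨ +-monoʳ-≤ (2 * a * d) 2at≤β ⟩
    2 * a * d + β          ∎)
    where open ≤-Reasoning

  module Bipartite (E : Fin m → Fin n → Bool) where

    degree : Subset n → Fin m → ℕ
    degree Z j = ∑[ k ∈ Z ] 𝟙 (E j k)

    neighbours : Fin n → Subset m
    neighbours k = tabulate (λ j → E j k)

    Complete : Subset m → Subset n → Set
    Complete R C = ∀ {j k} → j ∈ R → k ∈ C → E j k ≡ true

    degree≤∣Z∣ : ∀ Z j → degree Z j ≤ ∣ Z ∣
    degree≤∣Z∣ Z j = ≤-trans (∑-mono Z (λ {k} _ → 𝟙≤1 (E j k))) (≤-reflexive (sym (∣p∣≡∑1 Z)))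

    degree-remove : ∀ {Z y} j → y ∈ Z → degree Z j ≤ suc (degree (Z - y) j)
    degree-remove {Z} {y} j y∈Z = begin
      degree Z j                     ≡⟨ ∑-remove (λ k → 𝟙 (E j k)) y∈Z ⟩
      𝟙 (E j y) + degree (Z - y) j   ≤⟨ +-monoˡ-≤ _ (𝟙≤1 (E j y)) ⟩
      suc (degree (Z - y) j)         ∎
      where open ≤-Reasoning

    ∑𝟙≡∣R∩neighbours∣ : ∀ (R : Subset m) k → ∑[ j ∈ R ] 𝟙 (E j k) ≡ ∣ R ∩ neighbours k ∣
    ∑𝟙≡∣R∩neighbours∣ R k =
      trans (∑-cong R (λ j → cong 𝟙 (sym (lookup∘tabulate (λ j → E j k) j)))) (∑-indicator R _)

    ∃-popular-column : ∀ b β .{{_ : NonZero β}} (R : Subset m) (Z : Subset n) → Nonempty Z → ∣ Z ∣ ≤ β →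
                       (∀ {j} → j ∈ R → β ≤ b * degree Z j) →
                       ∃ λ y → y ∈ Z × ∣ R ∣ ≤ b * ∣ R ∩ neighbours y ∣
    ∃-popular-column b β R Z Z≢∅ ∣Z∣≤β β≤ with ∃-above-average (λ k → ∣ R ∩ neighbours k ∣) Z≢∅
    ... | y , y∈Z , ∑≤ = y , y∈Z , *-cancelˡ-≤ β (begin
      β * ∣ R ∣                             ≡⟨ trans (*-comm β ∣ R ∣) (sym (∑-const R β)) ⟩
      ∑[ j ∈ R ] β                          ≤⟨ ∑-mono R β≤ ⟩
      ∑[ j ∈ R ] (b * degree Z j)           ≡⟨ ∑-*ˡ R b _ ⟩
      b * ∑[ j ∈ R ] ∑[ k ∈ Z ] 𝟙 (E j k)   ≡⟨ cong (b *_) (∑-comm R Z _) ⟩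
      b * ∑[ k ∈ Z ] ∑[ j ∈ R ] 𝟙 (E j k)   ≡⟨ cong (b *_) (∑-cong Z (∑𝟙≡∣R∩neighbours∣ R)) ⟩
      b * ∑[ k ∈ Z ] ∣ R ∩ neighbours k ∣   ≤⟨ *-monoʳ-≤ b ∑≤ ⟩
      b * (∣ Z ∣ * ∣ R ∩ neighbours y ∣)    ≤⟨ *-monoʳ-≤ b (*-monoˡ-≤ _ ∣Z∣≤β) ⟩
      b * (β * ∣ R ∩ neighbours y ∣)        ≡⟨ *-left-comm b β _ ⟩
      β * (b * ∣ R ∩ neighbours y ∣)        ∎)
      where open ≤-Reasoning

    record Biclique (R : Subset m) (Z : Subset n) (s loss : ℕ) : Set where
      field
        rows      : Subset m
        columns   : Subset n
        rows⊆R    : rows ⊆ R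
        columns⊆Z : columns ⊆ Z
        ∣columns∣ : ∣ columns ∣ ≡ s
        ∣R∣≤      : ∣ R ∣ ≤ loss * ∣ rows ∣
        complete  : Complete rows columns

    -- t counts the columns already taken out of Z; the hypotheses are the invariants of the greedy
    -- choice, and with t = 0, ∣ Z ∣ = β they say that every row of R has degree ≥ β/a in Z.
    biclique : ∀ a .{{_ : NonZero a}} β s t (R : Subset m) (Z : Subset n) →
               2 * a * (t + s) ≤ β → β ≤ ∣ Z ∣ + t → ∣ Z ∣ ≤ β →
               (∀ {j} → j ∈ R → β ≤ a * (degree Z j + t)) →
               Biclique R Z s ((2 * a) ^ s)
    biclique a β zero t R Z _ _ _ _ = record
      { rows = R ; columns = ∅ ; rows⊆R = λ j∈R → j∈R ; columns⊆Z = ⊥⊆ ; ∣columns∣ = ∣⊥∣≡0 n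
      ; ∣R∣≤ = ≤-reflexive (sym (+-identityʳ ∣ R ∣)) ; complete = λ _ k∈∅ → ⊥-elim (∉⊥ k∈∅) }
    biclique a β (suc s) t R Z 2a[t+s]≤β β≤∣Z∣+t ∣Z∣≤β β≤deg =
      extend (∃-popular-column (2 * a) β {{>-nonZero (≤-trans (s≤s z≤n) 1+t≤β)}} R Z Z≢∅ ∣Z∣≤β β≤2a*deg)
      where
      1+t≤β : suc t ≤ β
      1+t≤β = ≤-trans (≤-trans (s≤s (m≤m+n t s)) (≤-reflexive (sym (+-suc t s))))
                      (≤-trans (m≤n*m (t + suc s) (2 * a) {{m*n≢0 2 a}}) 2a[t+s]≤β)
      Z≢∅ : Nonempty Z
      Z≢∅ = 1≤∣p∣⇒Nonempty (+-cancelʳ-≤ t 1 ∣ Z ∣ (≤-trans 1+t≤β β≤∣Z∣+t))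
      β≤2a*deg : ∀ {j} → j ∈ R → β ≤ 2 * a * degree Z j
      β≤2a*deg j∈R = halve-slack a _ t β (β≤deg j∈R) (≤-trans (*-monoʳ-≤ (2 * a) (m≤m+n t (suc s))) 2a[t+s]≤β)
      extend : (∃ λ y → y ∈ Z × ∣ R ∣ ≤ 2 * a * ∣ R ∩ neighbours y ∣) → Biclique R Z (suc s) ((2 * a) ^ suc s)
      extend (y , y∈Z , ∣R∣≤2a∣Ry∣) = record
        { rows      = Rest.rows
        ; columns   = Rest.columns ∪ ⁅ y ⁆
        ; rows⊆R    = p∩q⊆p R _ ∘ Rest.rows⊆R
        ; columns⊆Z = [ p─q⊆p Z _ ∘ Rest.columns⊆Z , (λ { refl → y∈Z }) ] ∘ x∈p∪⁅y⁆⁻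
        ; ∣columns∣ = trans (∣p∪⁅x⁆∣≡1+∣p∣ (x∉p-x ∘ Rest.columns⊆Z)) (cong suc Rest.∣columns∣)
        ; ∣R∣≤      = ≤-trans ∣R∣≤2a∣Ry∣ (≤-trans (*-monoʳ-≤ (2 * a) Rest.∣R∣≤)
                                                  (≤-reflexive (sym (*-assoc (2 * a) _ _))))
        ; complete  = λ j∈rows → [ Rest.complete j∈rows
                                 , (λ { refl → ∈-tabulate⁻ (p∩q⊆q R _ (Rest.rows⊆R j∈rows)) }) ] ∘ x∈p∪⁅y⁆⁻
        }
        where
        module Rest = Biclique (biclique a β s (suc t) (R ∩ neighbours y) (Z - y)
          (subst (λ u → 2 * a * u ≤ β) (+-suc t s) 2a[t+s]≤β)
          (≤-trans β≤∣Z∣+t (≤-reflexive (trans (cong (_+ t) (∣p∣≡1+∣p-x∣ y∈Z)) (sym (+-suc _ t)))))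
          (≤-trans (∣p─q∣≤∣p∣ Z _) ∣Z∣≤β)
          (λ {j} j∈Ry → ≤-trans (β≤deg (p∩q⊆p R _ j∈Ry))
            (*-monoʳ-≤ a (≤-trans (+-monoˡ-≤ t (degree-remove j y∈Z)) (≤-reflexive (sym (+-suc _ t)))))))

module Selection where

  open Subsets
  open DoubleCounting
  open import Defs
  import Data.Fin.Properties as Finₚ
  open import Data.Empty using (⊥-elim)
  open import Data.Fin using (Fin; _<_; _<?_)
  open import Data.Fin.Subset using (Subset; _∈_; _⊆_; _-_; ∁; ∣_∣; Nonempty) renaming (⊥ to ∅)
  open import Data.Fin.Subset.Properties using (p─q⊆p; ∣∁p∣≡n∸∣p∣; x∈∁p⇒x∉p)
  open import Data.List using (List; []; _∷_; length)
  open import Data.List.Membership.Propositional using () renaming (_∈_ to _∈ₗ_)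
  open import Data.List.Relation.Unary.All as All using ()
  open import Data.List.Relation.Unary.Any using (here; there)
  open import Data.List.Relation.Unary.AllPairs using ([]; _∷_)
  open import Data.List.Relation.Unary.Unique.Propositional using (Unique)
  open import Data.Nat using (ℕ; zero; suc; _+_; _∸_; _*_; _^_; _≤_; z≤n; s≤s; NonZero; >-nonZero; >-nonZero⁻¹)
  open import Data.Nat.Properties hiding (_<?_)
  open import Data.Product using (Σ; _×_; _,_; proj₁; proj₂)
  open import Data.Sum using (_⊎_; inj₁; inj₂)
  open import Data.Vec using (lookup)
  open import Data.Vec.Properties using (lookup⇒[]=)
  open import Function using (_∘_)
  open import Relation.Nullary using (yes; no; contradiction)
  open import Relation.Binary.PropositionalEquality

  module Thresholds (a n₂ : ℕ) where

    loss : ℕ → ℕ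
    loss q = a * (2 * a) ^ q

    -- One spare column keeps Y nonempty, as the averaging steps require.
    needY : ℕ → ℕ
    needY zero    = suc n₂
    needY (suc B) = 2 * a * needY B

    needX : ℕ → ℕ
    needX zero    = 0
    needX (suc B) = loss (needY B) * suc (needX B)

    Large : ∀ {N} → ℕ → Subset N → Subset N → Set
    Large B X Y = needX B ≤ ∣ X ∣ × needY B ≤ ∣ Y ∣

    -- Choosing the (t+1)-st index costs t link steps plus one unit for removing it from X.
    budget : ℕ → ℕ → ℕ
    budget zero    t = 0
    budget (suc k) t = suc (t + budget k (suc t))

  module Construction {N : ℕ} (A : Reduced3Graph N) (L : ∀ i j j′ k → Subset (Reduced3Graph.cls A i j))
    (r : ℕ) {{_ : NonZero r}} (n₂ : ℕ)
    (dense : ∀ {i j j′ k : Fin N} → i < j → j < j′ → j′ < k → Reduced3Graph.cls A i j ≤ r * ∣ L i j j′ k ∣)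
    where

    open Reduced3Graph A using (cls; nonempty)

    a : ℕ
    a = 2 * r

    open Thresholds a n₂

    instance
      a≢0 : NonZero a
      a≢0 = m*n≢0 2 r
      2a≢0 : NonZero (2 * a)
      2a≢0 = m*n≢0 2 a

    loss≢0 : ∀ q → NonZero (loss q)
    loss≢0 q = m*n≢0 a _ {{a≢0}} {{m^n≢0 (2 * a) q}}

    needY≢0 : ∀ B → NonZero (needY B)
    needY≢0 zero    = _
    needY≢0 (suc B) = m*n≢0 (2 * a) (needY B) {{2a≢0}} {{needY≢0 B}}

    needX-suc : ∀ B → suc (needX B) ≤ needX (suc B)
    needX-suc B = m≤n*m (suc (needX B)) (loss (needY B)) {{loss≢0 (needY B)}}

    Large-remove : ∀ {B} {X Y : Subset N} {x} → x ∈ X → Large (suc B) X Y → Large B (X - x) Y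
    Large-remove {B} x∈X (X-large , Y-large) =
      ≤-pred (≤-trans (needX-suc B) (≤-trans X-large (≤-reflexive (∣p∣≡1+∣p-x∣ x∈X)))) ,
      ≤-trans (m≤n*m (needY B) (2 * a)) Y-large

    _≪_ : Subset N → Subset N → Set
    X ≪ Y = ∀ {x y} → x ∈ X → y ∈ Y → x < y

    record Refinement (B : ℕ) (X Y : Subset N) (P : Subset N → Subset N → Set) : Set where
      field
        X′ Y′    : Subset N
        X′⊆X     : X′ ⊆ X
        Y′⊆Y     : Y′ ⊆ Y
        large    : Large B X′ Y′
        property : P X′ Y′

    link-step : ∀ {i m} B (X Y : Subset N) → i < m → (∀ {x} → x ∈ X → m < x) → X ≪ Y →
                Large (suc B) X Y →
                Σ (Fin (cls i m)) λ v →
                  Refinement B X Y (λ X′ Y′ → ∀ {j′ k} → j′ ∈ X′ → k ∈ Y′ → v ∈ L i m j′ k)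
    link-step {i} {m} B X Y i<m m<X X≪Y (X-large , Y-large)
      with ∃-popular {{>-nonZero (nonempty i m i<m)}} r X Y (L i m)
                     (λ j′∈X k∈Y → dense i<m (m<X j′∈X) (X≪Y j′∈X k∈Y))
    ... | v , popular = v , record
      { X′       = K.rows
      ; Y′       = K.columns
      ; X′⊆X     = proj₁ ∘ heavy⁻ {a = a} {d = degree Y} {β = ∣ Y ∣} ∘ K.rows⊆R
      ; Y′⊆Y     = K.columns⊆Z
      ; large    = needX≤∣rows∣ , ≤-reflexive (sym K.∣columns∣)
      ; property = λ j′∈ k∈ → lookup⇒[]= _ _ (K.complete j′∈ k∈)
      }
      where
      open Bipartite (λ j′ k → lookup (L i m j′ k) v)
      q = needY B
      instance
        ∣Y∣≢0 : NonZero ∣ Y ∣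
        ∣Y∣≢0 = >-nonZero (≤-trans (>-nonZero⁻¹ _ {{needY≢0 (suc B)}}) Y-large)
      H = heavy a (degree Y) ∣ Y ∣ X
      ∣X∣≤a∣H∣ : ∣ X ∣ ≤ a * ∣ H ∣
      ∣X∣≤a∣H∣ = ∣X∣≤2r*∣heavy∣ r (degree Y) ∣ Y ∣ X (λ {j} _ → degree≤∣Z∣ Y j) popular
      module K = Biclique (biclique a ∣ Y ∣ q 0 H Y Y-large (≤-reflexive (sym (+-identityʳ _))) ≤-refl
        (λ j∈H → subst (λ d → ∣ Y ∣ ≤ a * d) (sym (+-identityʳ _))
                       (proj₂ (heavy⁻ {a = a} {d = degree Y} {β = ∣ Y ∣} j∈H))))
      needX≤∣rows∣ : needX B ≤ ∣ K.rows ∣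
      needX≤∣rows∣ = <⇒≤ (*-cancelˡ-≤ (loss q) {{loss≢0 q}} (begin
        loss q * suc (needX B)          ≤⟨ X-large ⟩
        ∣ X ∣                           ≤⟨ ∣X∣≤a∣H∣ ⟩
        a * ∣ H ∣                       ≤⟨ *-monoʳ-≤ a K.∣R∣≤ ⟩
        a * ((2 * a) ^ q * ∣ K.rows ∣)  ≡⟨ *-assoc a _ _ ⟨
        loss q * ∣ K.rows ∣             ∎))
        where open ≤-Reasoning

    record Column (l : List (Fin N)) (m : Fin N) (X Y : Subset N) : Set where
      field
        ℓ   : ∀ {i} → i ∈ₗ l → Fin (cls i m)
        ℓ∈L : ∀ {i j′ k} (i∈l : i ∈ₗ l) → j′ ∈ X → k ∈ Y → ℓ i∈l ∈ L i m j′ k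

    column : ∀ l B {m} (X Y : Subset N) → (∀ {i} → i ∈ₗ l → i < m) → (∀ {x} → x ∈ X → m < x) →
             X ≪ Y → Large (length l + B) X Y → Refinement B X Y (Column l m)
    column [] B X Y _ _ _ large = record
      { X′ = X ; Y′ = Y ; X′⊆X = λ x∈ → x∈ ; Y′⊆Y = λ y∈ → y∈ ; large = large
      ; property = record { ℓ = λ () ; ℓ∈L = λ () } }
    column (i ∷ l) B X Y l<m m<X X≪Y large with link-step (length l + B) X Y (l<m (here refl)) m<X X≪Y large
    ... | v , S = record
      { X′       = R.X′
      ; Y′       = R.Y′
      ; X′⊆X     = S.X′⊆X ∘ R.X′⊆X
      ; Y′⊆Y     = S.Y′⊆Y ∘ R.Y′⊆Y
      ; large    = R.large
      ; property = record
        { ℓ   = λ { (here refl) → v ; (there i∈l) → Column.ℓ R.property i∈l }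
        ; ℓ∈L = λ { (here refl) j′∈ k∈ → S.property (R.X′⊆X j′∈) (R.Y′⊆Y k∈)
                  ; (there i∈l) → Column.ℓ∈L R.property i∈l }
        }
      }
      where
      module S = Refinement S
      module R = Refinement (column l B S.X′ S.Y′ (l<m ∘ there) (m<X ∘ S.X′⊆X)
                                    (λ x∈ y∈ → X≪Y (S.X′⊆X x∈) (S.Y′⊆Y y∈)) S.large)

    record Configuration : Set where
      field
        chosen   : List (Fin N)
        X Y      : Subset N
        distinct : Unique chosen
        chosen<X : ∀ {i x} → i ∈ₗ chosen → x ∈ X → i < x
        chosen<Y : ∀ {i y} → i ∈ₗ chosen → y ∈ Y → i < y
        X≪Y      : X ≪ Y
        ℓ        : ∀ {i j} → i ∈ₗ chosen → j ∈ₗ chosen → i < j → Fin (cls i j)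
        ℓ∈L      : ∀ {i j j′ k} (i∈ : i ∈ₗ chosen) (j∈ : j ∈ₗ chosen) (i<j : i < j) → j < j′ →
                   j′ ∈ₗ chosen ⊎ j′ ∈ X → k ∈ Y → ℓ i∈ j∈ i<j ∈ L i j j′ k

    empty-configuration : ∀ X Y → X ≪ Y → Configuration
    empty-configuration X Y X≪Y = record
      { chosen = [] ; X = X ; Y = Y ; distinct = [] ; chosen<X = λ () ; chosen<Y = λ () ; X≪Y = X≪Y
      ; ℓ = λ () ; ℓ∈L = λ () }

    extend : ∀ B (C : Configuration) → let open Configuration C in
             Large (suc (length chosen + B)) X Y →
             Σ Configuration λ C′ → length (Configuration.chosen C′) ≡ suc (length chosen) ×
                                    Large B (Configuration.X C′) (Configuration.Y C′)
    extend B C large = record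
      { chosen   = m ∷ chosen
      ; X        = Col.X′
      ; Y        = Col.Y′
      ; distinct = All.tabulate (λ i∈ m≡i → Finₚ.<-irrefl (sym m≡i) (chosen<m i∈)) ∷ distinct
      ; chosen<X = λ { (here refl) x∈ → m<X₁ (Col.X′⊆X x∈) ; (there i∈) x∈ → chosen<X i∈ (X₁⊆X (Col.X′⊆X x∈)) }
      ; chosen<Y = λ { (here refl) y∈ → X≪Y m∈X (Col.Y′⊆Y y∈) ; (there i∈) y∈ → chosen<Y i∈ (Col.Y′⊆Y y∈) }
      ; X≪Y      = λ x∈ y∈ → X≪Y (X₁⊆X (Col.X′⊆X x∈)) (Col.Y′⊆Y y∈)
      ; ℓ        = ℓ′
      ; ℓ∈L      = ℓ′∈L
      } , refl , Col.large
      where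
      open Configuration C
      X≢∅ : Nonempty X
      X≢∅ = 1≤∣p∣⇒Nonempty (≤-trans (s≤s z≤n) (≤-trans (needX-suc (length chosen + B)) (proj₁ large)))
      min = minimum X≢∅
      m = proj₁ min
      m∈X = proj₁ (proj₂ min)
      chosen<m : ∀ {i} → i ∈ₗ chosen → i < m
      chosen<m i∈ = chosen<X i∈ m∈X
      X₁ = X - m
      X₁⊆X : X₁ ⊆ X
      X₁⊆X = p─q⊆p X _
      m<X₁ : ∀ {x} → x ∈ X₁ → m < x
      m<X₁ x∈X₁ = Finₚ.≤∧≢⇒< (proj₂ (proj₂ min) (X₁⊆X x∈X₁)) (λ { refl → x∉p-x x∈X₁ })
      module Col = Refinement (column chosen B X₁ Y chosen<m m<X₁ (X≪Y ∘ X₁⊆X)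
                                      (Large-remove {length chosen + B} {Y = Y} m∈X large))
      open Column Col.property renaming (ℓ to ℓₘ; ℓ∈L to ℓₘ∈L)
      drop-m : ∀ {i} → i ∈ₗ m ∷ chosen → i < m → i ∈ₗ chosen
      drop-m (here refl) i<m = ⊥-elim (Finₚ.<-irrefl refl i<m)
      drop-m (there i∈)  _   = i∈
      ℓ′ : ∀ {i j} → i ∈ₗ m ∷ chosen → j ∈ₗ m ∷ chosen → i < j → Fin (cls i j)
      ℓ′ i∈ (here refl) i<m = ℓₘ (drop-m i∈ i<m)
      ℓ′ i∈ (there j∈)  i<j = ℓ (drop-m i∈ (Finₚ.<-trans i<j (chosen<m j∈))) j∈ i<j
      old : ∀ {j′} → j′ ∈ₗ m ∷ chosen ⊎ j′ ∈ Col.X′ → j′ ∈ₗ chosen ⊎ j′ ∈ X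
      old (inj₁ (here refl)) = inj₂ m∈X
      old (inj₁ (there j′∈)) = inj₁ j′∈
      old (inj₂ j′∈)         = inj₂ (X₁⊆X (Col.X′⊆X j′∈))
      ℓ′∈L : ∀ {i j j′ k} (i∈ : i ∈ₗ m ∷ chosen) (j∈ : j ∈ₗ m ∷ chosen) (i<j : i < j) → j < j′ →
             j′ ∈ₗ m ∷ chosen ⊎ j′ ∈ Col.X′ → k ∈ Col.Y′ → ℓ′ i∈ j∈ i<j ∈ L i j j′ k
      ℓ′∈L _ (here refl) _ m<j′ (inj₁ (here refl))  _  = ⊥-elim (Finₚ.<-irrefl refl m<j′)
      ℓ′∈L _ (here refl) _ m<j′ (inj₁ (there j′∈)) _  = ⊥-elim (Finₚ.<-asym m<j′ (chosen<m j′∈))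
      ℓ′∈L _ (here refl) _ _    (inj₂ j′∈)         k∈ = ℓₘ∈L _ j′∈ k∈
      ℓ′∈L _ (there j∈)  i<j j<j′ j′∈              k∈ = ℓ∈L _ j∈ i<j j<j′ (old j′∈) (Col.Y′⊆Y k∈)

    grow : ∀ k (C : Configuration) → let open Configuration C in
           Large (budget k (length chosen)) X Y →
           Σ Configuration λ C′ → length (Configuration.chosen C′) ≡ length chosen + k ×
                                  Large 0 (Configuration.X C′) (Configuration.Y C′)
    grow zero    C large = C , sym (+-identityʳ _) , large
    grow (suc k) C large with extend (budget k (suc (length (Configuration.chosen C)))) C large
    ... | C₁ , ∣C₁∣≡ , large₁ with grow k C₁ (subst (λ t → Large (budget k t) (Configuration.X C₁) (Configuration.Y C₁))
                                                     (sym ∣C₁∣≡) large₁)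
    ... | C₂ , ∣C₂∣≡ , large₂ = C₂ , trans ∣C₂∣≡ (trans (cong (_+ k) ∣C₁∣≡) (sym (+-suc _ k))) , large₂

  module _ {N : ℕ} (A : Reduced3Graph N) where

    open Reduced3Graph A using (cls)

    Links : Set
    Links = (i j j′ k : Fin N) → i < j → j < j′ → j′ < k → Subset (cls i j)

    Selected : Links → ℕ → ℕ → Set
    Selected L n₁ n₂ =
      Σ (Subset N) λ I₁ → Σ (Subset N) λ I₂ →
        (∣ I₁ ∣ ≡ n₁) × (∣ I₂ ∣ ≡ n₂) ×
        ((a b : Fin N) → a ∈ I₁ → b ∈ I₂ → a < b) ×
        Σ ((i j : Fin N) → i ∈ I₁ → j ∈ I₁ → i < j → Fin (cls i j)) λ ℓ →
          ((i j j′ k : Fin N) (hi : i ∈ I₁) (hj : j ∈ I₁) (hj′ : j′ ∈ I₁) (hk : k ∈ I₂)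
           (p : i < j) (q : j < j′) (r : j′ < k) →
             ℓ i j hi hj p ∈ L i j j′ k p q r)

    totalise : Links → ∀ i j j′ k → Subset (cls i j)
    totalise L i j j′ k with i <? j | j <? j′ | j′ <? k
    ... | yes p | yes q | yes r = L i j j′ k p q r
    ... | _     | _     | _     = ∅

    totalise-≡ : ∀ (L : Links) {i j j′ k} (p : i < j) (q : j < j′) (r : j′ < k) →
                 totalise L i j j′ k ≡ L i j j′ k p q r
    totalise-≡ L {i} {j} {j′} {k} p q r with i <? j | j <? j′ | j′ <? k
    ... | yes p′ | yes q′ | yes r′
      rewrite Finₚ.<-irrelevant p′ p | Finₚ.<-irrelevant q′ q | Finₚ.<-irrelevant r′ r = refl
    ... | no ¬p  | _      | _      = contradiction p ¬p
    ... | yes _  | no ¬q  | _      = contradiction q ¬q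
    ... | yes _  | yes _  | no ¬r  = contradiction r ¬r

  bound : ℕ → ℕ → ℕ → ℕ
  bound r n₁ n₂ = needX (budget n₁ 0) + needY (budget n₁ 0)
    where open Thresholds (2 * r) n₂

  selection : ∀ r {{_ : NonZero r}} n₁ n₂ (A : Reduced3Graph (bound r n₁ n₂)) (L : Links A) →
              (∀ i j j′ k (p : i < j) (q : j < j′) (s : j′ < k) →
                 Reduced3Graph.cls A i j ≤ r * ∣ L i j j′ k p q s ∣) →
              Selected A L n₁ n₂
  selection r n₁ n₂ A L dense = select (grow n₁ start large₀)
    where
    open Thresholds (2 * r) n₂
    B₀ = budget n₁ 0
    open Construction A (totalise A L) r n₂
      (λ p q s → subst (λ S → _ ≤ r * ∣ S ∣) (sym (totalise-≡ A L p q s)) (dense _ _ _ _ p q s))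
    X₀ = initial (needX B₀)
    Y₀ = ∁ X₀
    start = empty-configuration X₀ Y₀ (λ x∈ y∈ → initial<rest (needX B₀) x∈ (x∈∁p⇒x∉p y∈))
    large₀ : Large B₀ X₀ Y₀
    large₀ = ≤-reflexive (sym (∣initial∣ (needX B₀))) ,
             ≤-reflexive (sym (trans (∣∁p∣≡n∸∣p∣ X₀) (trans (cong (bound r n₁ n₂ ∸_) (∣initial∣ (needX B₀)))
                                                                (m+n∸m≡n (needX B₀) _))))
    select : (Σ Configuration λ C → let open Configuration C in length chosen ≡ n₁ × Large 0 X Y) →
             Selected A L n₁ n₂
    select (C , ∣chosen∣≡n₁ , _ , Y-large) =
      let open Configuration C
          (I₂ , I₂⊆Y , ∣I₂∣≡n₂) = ∃-subset-of-size Y (≤-trans (n≤1+n n₂) Y-large)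
      in fromList chosen , I₂ , trans (∣fromList∣ distinct) ∣chosen∣≡n₁ , ∣I₂∣≡n₂ ,
         (λ a b a∈ b∈ → chosen<Y (∈-fromList⁻ a∈) (I₂⊆Y b∈)) ,
         (λ i j i∈ j∈ → ℓ (∈-fromList⁻ i∈) (∈-fromList⁻ j∈)) ,
         (λ i j j′ k i∈ j∈ j′∈ k∈ p q s →
            subst (_ ∈_) (totalise-≡ A L p q s)
                  (ℓ∈L (∈-fromList⁻ i∈) (∈-fromList⁻ j∈) p q (inj₁ (∈-fromList⁻ j′∈)) (I₂⊆Y k∈)))

module DensityBound where

  open import Defs
  open import Data.Nat as ℕ using (ℕ; suc)
  open import Data.Nat.Properties using (≤-trans; ≤-reflexive; m≤m+n; *-comm; *-identityʳ)
  open import Data.Integer as ℤ using (+_; +[1+_]; -[1+_])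
  import Data.Integer.Properties as ℤ
  open import Data.Nat.Coprimality using (1-coprimeTo) renaming (sym to coprime-sym)
  open import Data.Rational using (ℚ; mkℚ; 0ℚ; _*_; ↧ₙ_; *<*) renaming (_<_ to _<ℚ_; _≤_ to _≤ℚ_)
  open import Data.Rational.Properties using (toℚᵘ-mono-≤; toℚᵘ-homo-*; ↥p/↧p≡p)
  import Data.Rational.Unnormalised as ℚᵘ
  import Data.Rational.Unnormalised.Properties as ℚᵘ
  open import Data.Sign using (Sign)
  open import Relation.Binary.PropositionalEquality

  ℕ→ℚ≡mkℚ : ∀ n → ℕ→ℚ n ≡ mkℚ (+ n) 0 (coprime-sym (1-coprimeTo n))
  ℕ→ℚ≡mkℚ n = ↥p/↧p≡p (mkℚ (+ n) 0 (coprime-sym (1-coprimeTo n)))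

  -- For δ = (1 + a)/(1 + d) in lowest terms, δ c ≤ l means (1 + a) c ≤ (1 + d) l.
  denominator-bound : ∀ δ → 0ℚ <ℚ δ → ∀ c l → δ * ℕ→ℚ c ≤ℚ ℕ→ℚ l → c ℕ.≤ ↧ₙ δ ℕ.* l
  denominator-bound (mkℚ (+ 0) _ _)    (*<* (ℤ.+<+ ()))
  denominator-bound (mkℚ -[1+ _ ] _ _) (*<* ())
  denominator-bound δ@(mkℚ +[1+ a ] d _) _ c l δc≤l
    rewrite ℕ→ℚ≡mkℚ c | ℕ→ℚ≡mkℚ l
    with ℚᵘ.≤-respˡ-≃ (toℚᵘ-homo-* δ (mkℚ (+ c) 0 (coprime-sym (1-coprimeTo c)))) (toℚᵘ-mono-≤ δc≤l)
  ... | ℚᵘ.*≤* [1+a]c≤ld =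
    ≤-trans (m≤m+n c (a ℕ.* c)) (≤-trans (ℤ.drop‿+≤+ (subst₂ ℤ._≤_ lhs rhs [1+a]c≤ld)) (≤-reflexive ld≡))
    where
    lhs : (Sign.+ ℤ.◃ (c ℕ.+ a ℕ.* c)) ℤ.* + 1 ≡ + (c ℕ.+ a ℕ.* c)
    lhs = trans (ℤ.*-identityʳ _) (ℤ.+◃n≡+n _)
    rhs : + l ℤ.* + suc (d ℕ.* 1) ≡ + (l ℕ.* suc (d ℕ.* 1))
    rhs = sym (ℤ.pos-* l (suc (d ℕ.* 1)))
    ld≡ : l ℕ.* suc (d ℕ.* 1) ≡ suc d ℕ.* l
    ld≡ = trans (*-comm l _) (cong (λ u → suc u ℕ.* l) (*-identityʳ d))

open import Defs
open import Data.Nat using (ℕ)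
open import Data.Fin using (Fin; _<_)
open import Data.Fin.Subset using (Subset; _∈_; ∣_∣)
open import Data.Rational using (ℚ; 0ℚ; _*_; ↧ₙ_) renaming (_<_ to _<ℚ_; _≤_ to _≤ℚ_)
open import Data.Product using (Σ; ∃; _×_; _,_)
open import Relation.Binary.PropositionalEquality using (_≡_)
open Selection using (bound; selection)
open DensityBound using (denominator-bound)

lemma3p5 : (δ : ℚ) → 0ℚ <ℚ δ → (n₁ n₂ : ℕ) →
    ∃ λ (N : ℕ) →
      (A : Reduced3Graph N) →
      (L : (i j j′ k : Fin N) → i < j → j < j′ → j′ < k →
           Subset (Reduced3Graph.cls A i j)) →
      ((i j j′ k : Fin N) (p : i < j) (q : j < j′) (r : j′ < k) →
         δ * ℕ→ℚ (Reduced3Graph.cls A i j) ≤ℚ ℕ→ℚ ∣ L i j j′ k p q r ∣) →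
      Σ (Subset N) λ I₁ → Σ (Subset N) λ I₂ →
        (∣ I₁ ∣ ≡ n₁) × (∣ I₂ ∣ ≡ n₂) ×
        ((a b : Fin N) → a ∈ I₁ → b ∈ I₂ → a < b) ×
        Σ ((i j : Fin N) → i ∈ I₁ → j ∈ I₁ → i < j → Fin (Reduced3Graph.cls A i j)) λ ℓ →
          ((i j j′ k : Fin N) (hi : i ∈ I₁) (hj : j ∈ I₁) (hj′ : j′ ∈ I₁) (hk : k ∈ I₂)
           (p : i < j) (q : j < j′) (r : j′ < k) →
             ℓ i j hi hj p ∈ L i j j′ k p q r)
lemma3p5 δ δ>0 n₁ n₂ = bound (↧ₙ δ) n₁ n₂ , λ A L δ-dense →
  selection (↧ₙ δ) n₁ n₂ A L (λ i j j′ k p q r → denominator-bound δ δ>0 _ _ (δ-dense i j j′ k p q r))
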